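{- Let $H$ be a $d$-regular graph with adjacency matrix $M$, let $G$ be a lift of $H$, and let $G'$ be a graph on $V(G)$ that $H$-respects $G$. Then $\chi(G')\le\chi(H)$; that is, $-\chi$ satisfies $-\chi(G')\ge-\chi(H)$.
   Context: $\chi$ is the chromatic number. Lifts: a graph $G$ on $km$ vertices is a lift of $H$ ($k$ vertices) if there is a balanced partition $\sigma:V(G)\to[k]$ such that each fiber $\sigma^{ -1}(i)$ induces an $M_{ii}$-regular graph, and for $i\ne j$ the edges between fibers $i$ and $j$ form an $M_{ij}$-regular bipartite graph. $G'$ $H$-respects $G$ if $G'$ contains no edge between the fibers of $i,j\in V(H)$ with $M_{ij}=0$. -}

module Defs where

open import Data.Nat using (ℕ; zero; suc; _+_; _*_; _<_)
open import Data.Fin using (Fin; zero; suc; _≟_)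
open import Data.Bool using (Bool; true; false; if_then_else_; _∧_)
open import Relation.Nullary.Decidable using (⌊_⌋)
open import Relation.Binary.PropositionalEquality using (_≡_; _≢_)
open import Relation.Nullary using (¬_)

count : ∀ {n} → (Fin n → Bool) → ℕ
count {zero}  f = 0
count {suc n} f = (if f zero then 1 else 0) + count (λ x → f (suc x))

record Graph (n : ℕ) : Set where
  field
    adj      : Fin n → Fin n → Bool
    adj-sym  : ∀ u v → adj u v ≡ adj v u
    loopless : ∀ v → adj v v ≡ false
open Graph public

adjMatrix : ∀ {n} → Graph n → Fin n → Fin n → ℕ
adjMatrix H i j = if adj H i j then 1 else 0

degree : ∀ {n} → Graph n → Fin n → ℕ
degree H v = count (adj H v)

IsRegular : ∀ {n} → Graph n → ℕ → Set
IsRegular H d = ∀ v → degree H v ≡ d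

-- G (on k*m vertices) is a lift of H (on k vertices) via the partition σ:
--  * σ is balanced: every fiber σ⁻¹(i) has exactly m vertices;
--  * every vertex v has exactly M_{σ(v) j} neighbours in fiber j, for every j.
--    (For j = σ v this says fiber σ v induces an M_{ii}-regular graph; for
--     j ≠ σ v it says the edges between fibers form an M_{ij}-regular bipartite graph.)
record Lift {k m : ℕ} (H : Graph k) (G : Graph (k * m)) : Set where
  field
    σ        : Fin (k * m) → Fin k
    balanced : ∀ i → count (λ v → ⌊ σ v ≟ i ⌋) ≡ m
    fiberReg : ∀ v j → count (λ w → adj G v w ∧ ⌊ σ w ≟ j ⌋) ≡ adjMatrix H (σ v) j
open Lift public

Respects : ∀ {k m} {H : Graph k} {G : Graph (k * m)} → Lift H G → Graph (k * m) → Set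
Respects {H = H} L G' =
  ∀ u v → adj G' u v ≡ true → ¬ (adjMatrix H (σ L u) (σ L v) ≡ 0)

ProperColouring : ∀ {n} → Graph n → (c : ℕ) → (Fin n → Fin c) → Set
ProperColouring G c col = ∀ u v → adj G u v ≡ true → col u ≢ col v

Colourable : ∀ {n} → Graph n → ℕ → Set
Colourable {n} G c = Σ' (Fin n → Fin c) (ProperColouring G c)
  where
    open import Data.Product using () renaming (Σ to Σ')

IsChromaticNumber : ∀ {n} → Graph n → ℕ → Set
IsChromaticNumber G c = Colourable G c × (∀ j → j < c → ¬ Colourable G j)
  where open import Data.Product using (_×_)

{-# OPTIONS --safe #-}
module Submission where

open import Defs
open import Data.Nat using (ℕ; _*_; _≤_; _≤?_)
open import Data.Nat.Properties using (≰⇒>)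
open import Data.Bool using (true; false)
open import Data.Product using (_,_; proj₁)
open import Data.Fin using (Fin)
open import Data.Empty using (⊥-elim)
open import Function using (_∘_)
open import Relation.Binary.PropositionalEquality using (_≡_; _≢_; refl)
open import Relation.Nullary using (yes; no)

-- The fibre map σ of the lift is a homomorphism G' → H, so every colouring
-- of H pulls back along σ.

IsHomomorphism : ∀ {n k} → Graph n → Graph k → (Fin n → Fin k) → Set
IsHomomorphism G H f = ∀ u v → adj G u v ≡ true → adj H (f u) (f v) ≡ true

adjMatrix≢0⇒adj : ∀ {k} (H : Graph k) i j → adjMatrix H i j ≢ 0 → adj H i j ≡ true
adjMatrix≢0⇒adj H i j M≢0 with adj H i j
... | true  = refl
... | false = ⊥-elim (M≢0 refl)

respects⇒σ-homomorphism : ∀ {k m} {H : Graph k} {G G' : Graph (k * m)} (L : Lift H G) →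
  Respects L G' → IsHomomorphism G' H (σ L)
respects⇒σ-homomorphism {H = H} L resp u v e =
  adjMatrix≢0⇒adj H (σ L u) (σ L v) (resp u v e)

colourable-pullback : ∀ {n k c} {G : Graph n} {H : Graph k} (f : Fin n → Fin k) →
  IsHomomorphism G H f → Colourable H c → Colourable G c
colourable-pullback f hom (col , proper) =
  col ∘ f , λ u v e → proper (f u) (f v) (hom u v e)

chromaticNumber≤ : ∀ {n χ c} {G : Graph n} →
  IsChromaticNumber G χ → Colourable G c → χ ≤ c
chromaticNumber≤ {χ = χ} {c} (_ , minimal) colourable with χ ≤? c
... | yes χ≤c = χ≤c
... | no  χ≰c = ⊥-elim (minimal c (≰⇒> χ≰c) colourable)

proposition4p10 : (k m d : ℕ) (H : Graph k) → IsRegular H d →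
    (G : Graph (k * m)) (L : Lift H G) (G' : Graph (k * m)) → Respects L G' →
    (χG' χH : ℕ) → IsChromaticNumber G' χG' → IsChromaticNumber H χH → χG' ≤ χH
proposition4p10 k m d H _ G L G' resp χG' χH χ[G'] χ[H] =
  chromaticNumber≤ {G = G'} χ[G'] G'-colourable
  where
    G'-colourable : Colourable G' χH
    G'-colourable = colourable-pullback {c = χH} {G = G'} {H = H} (σ L)
      (respects⇒σ-homomorphism {G' = G'} L resp) (proj₁ χ[H])
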